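{- Let $d\ge 1$ and $q\ge 2$ be integers, let $G$ be a connected $K_{1,d}$-free graph, and let $P$ be an induced path in $G$ on $q$ vertices. Then $\alpha(G[N[V(P)]])\le (d-1)q$.
   Context: Graphs are finite and simple; $K_{1,d}$-free means no induced star with $d$ leaves. $N[X]$ denotes the closed neighborhood of a vertex set $X$; $\alpha$ is the independence number. -}

module Defs where

open import Data.Nat using (ℕ; suc; _+_; _≤_)
open import Data.Fin using (Fin; toℕ)
open import Data.Product using (Σ; ∃; _×_; _,_)
open import Data.Sum using (_⊎_)
open import Data.List using (List; []; _∷_; length)
open import Data.List.Membership.Propositional using (_∈_)
open import Data.List.Relation.Unary.AllPairs using (AllPairs)
open import Data.List.Relation.Unary.All using (All)
open import Relation.Binary.PropositionalEquality using (_≡_)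
open import Relation.Nullary using (¬_)
open import Level using (0ℓ)

record Graph (n : ℕ) : Set₁ where
  field
    Adj   : Fin n → Fin n → Set
    sym   : ∀ {u v} → Adj u v → Adj v u
    irrefl : ∀ {v} → ¬ Adj v v
open Graph public

data Walk {n : ℕ} (G : Graph n) : Fin n → Fin n → Set where
  here : ∀ {u} → Walk G u u
  step : ∀ {u w v} → Adj G u w → Walk G w v → Walk G u v

Connected : ∀ {n} → Graph n → Set
Connected G = ∀ u v → Walk G u v

IsIndependent : ∀ {n} → Graph n → List (Fin n) → Set
IsIndependent G S = AllPairs (λ u v → ¬ u ≡ v × ¬ Adj G u v) S

-- G is K_{1,d}-free: no vertex has an independent set of d neighbours
-- (an induced K_{1,d} is a center v and d pairwise nonadjacent distinct
-- neighbours of v).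
K1-Free : ∀ {n} → ℕ → Graph n → Set
K1-Free {n} d G =
  ∀ (v : Fin n) (S : List (Fin n)) →
    IsIndependent G S → All (Adj G v) S → ¬ length S ≡ d

IsInducedPath : ∀ {n} (G : Graph n) (q : ℕ) → (Fin q → Fin n) → Set
IsInducedPath G q p =
  (∀ i j → p i ≡ p j → i ≡ j) ×
  (∀ i j → (Adj G (p i) (p j) → (suc (toℕ i) ≡ toℕ j ⊎ suc (toℕ j) ≡ toℕ i))
          × ((suc (toℕ i) ≡ toℕ j ⊎ suc (toℕ j) ≡ toℕ i) → Adj G (p i) (p j)))

InClosedNbhd : ∀ {n} (G : Graph n) {q : ℕ} → (Fin q → Fin n) → Fin n → Set
InClosedNbhd G {q} p v = ∃ λ (i : Fin q) → p i ≡ v ⊎ Adj G (p i) v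

-- In a K₁,d-free graph an independent set inside a closed neighbourhood N[v]
-- has at most d - 1 vertices: either it contains v, and then it is {v}, or it
-- lies in N(v), where d of its vertices would be the leaves of an induced
-- K₁,d.  Since N[V(P)] is covered by the q sets N[p i], every independent set
-- in it has at most (d - 1) q vertices.  For d = 1 the graph is edgeless,
-- which an induced path on q ≥ 2 vertices rules out.
module Submission where

open import Defs
open import Data.Nat using (ℕ; _≤_; _*_; _∸_; _⊔_; zero; suc; _+_; z≤n; s≤s)
open import Data.Nat.Properties using (≤-trans; ≤-reflexive; +-mono-≤; +-suc; *-comm; ≰⇒>; _≤?_; m≤n⇒m⊓n≡m; m≤m⊔n; m≤n⊔m)
open import Data.Fin using (Fin; zero; suc; _≟_)
open import Data.List using (List; length; []; _∷_; take)
open import Data.List.Properties using (length-take)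
open import Data.List.Membership.Propositional using (_∈_)
open import Data.List.Relation.Unary.All as All using (All; []; _∷_)
import Data.List.Relation.Unary.All.Properties as Allₚ
open import Data.List.Relation.Unary.Any using (here; there)
open import Data.List.Relation.Unary.AllPairs using (AllPairs; []; _∷_)
import Data.List.Relation.Unary.AllPairs.Properties as AllPairsₚ
open import Data.List.Relation.Binary.Sublist.Propositional using (_⊆_; []; _∷_; _∷ʳ_)
open import Data.List.Relation.Binary.Sublist.Propositional.Properties using (All-resp-⊆)
open import Data.Product using (∃; ∃₂; _×_; _,_; proj₂)
open import Data.Sum using (_⊎_; inj₁; inj₂; [_,_])
open import Data.Empty using (⊥-elim)
open import Function using (_∘_; id)
open import Relation.Nullary using (¬_; yes; no)
open import Relation.Binary.PropositionalEquality using (_≡_; refl; cong; subst) renaming (sym to ≡-sym)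

AllPairs-resp-⊆ : ∀ {A : Set} {R : A → A → Set} {xs ys : List A} →
                  xs ⊆ ys → AllPairs R ys → AllPairs R xs
AllPairs-resp-⊆ []          []       = []
AllPairs-resp-⊆ (_ ∷ʳ xs⊆ys) (_ ∷ rs) = AllPairs-resp-⊆ xs⊆ys rs
AllPairs-resp-⊆ (refl ∷ xs⊆ys) (r ∷ rs) = All-resp-⊆ xs⊆ys r ∷ AllPairs-resp-⊆ xs⊆ys rs

split-by-first-class : ∀ {A : Set} {q} {Q : Fin (suc q) → A → Set} (S : List A) →
  All (λ s → ∃ λ i → Q i s) S →
  ∃₂ λ T U → T ⊆ S × U ⊆ S × All (Q zero) T × All (λ s → ∃ λ i → Q (suc i) s) U ×
             length S ≤ length T + length U
split-by-first-class [] [] = [] , [] , [] , [] , [] , [] , z≤n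
split-by-first-class (x ∷ S) ((i , qx) ∷ classified)
  with split-by-first-class S classified | i
... | T , U , T⊆S , U⊆S , inT , inU , len | zero =
  x ∷ T , U , refl ∷ T⊆S , x ∷ʳ U⊆S , qx ∷ inT , inU , s≤s len
... | T , U , T⊆S , U⊆S , inT , inU , len | suc j =
  T , x ∷ U , x ∷ʳ T⊆S , refl ∷ U⊆S , inT , (j , qx) ∷ inU ,
  subst (suc (length S) ≤_) (≡-sym (+-suc (length T) (length U))) (s≤s len)

AllPairs-covered-length-≤ : ∀ {A : Set} {R : A → A → Set} (c q : ℕ) (Q : Fin q → A → Set) →
  (∀ i T → AllPairs R T → All (Q i) T → length T ≤ c) →
  ∀ S → AllPairs R S → All (λ s → ∃ λ i → Q i s) S → length S ≤ q * c
AllPairs-covered-length-≤ c zero    Q bound []      _ _                = z≤n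
AllPairs-covered-length-≤ c zero    Q bound (_ ∷ _) _ ((() , _) ∷ _)
AllPairs-covered-length-≤ c (suc q) Q bound S rs classified
  with split-by-first-class S classified
... | T , U , T⊆S , U⊆S , inT , inU , len =
  ≤-trans len (+-mono-≤ (bound zero T (AllPairs-resp-⊆ T⊆S rs) inT)
    (AllPairs-covered-length-≤ c q (Q ∘ suc) (bound ∘ suc) U (AllPairs-resp-⊆ U⊆S rs) inU))

module _ {n : ℕ} (G : Graph n) where

  open import Data.List.Membership.DecPropositional (_≟_ {n}) using (_∈?_)

  ClosedAdj : Fin n → Fin n → Set
  ClosedAdj u v = u ≡ v ⊎ Adj G u v

  K1-Free-1⇒edgeless : K1-Free 1 G → ∀ {u v} → ¬ Adj G u v
  K1-Free-1⇒edgeless k1 {u} {v} u~v = k1 u (v ∷ []) ([] ∷ []) (u~v ∷ []) refl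

  nbhd-independent-length-≤ : ∀ {d v T} → K1-Free (suc d) G →
    IsIndependent G T → All (Adj G v) T → length T ≤ d
  nbhd-independent-length-≤ {d} {v} {T} k1 ind adj with length T ≤? d
  ... | yes len = len
  ... | no  len = ⊥-elim (k1 v (take (suc d) T) (AllPairsₚ.take⁺ (suc d) ind) (Allₚ.take⁺ (suc d) adj)
                    (subst (_≡ suc d) (≡-sym (length-take (suc d) T)) (m≤n⇒m⊓n≡m (≰⇒> len))))

  independent-∷-closedNbhd-length-≤ : ∀ {v T} → IsIndependent G (v ∷ T) →
    All (ClosedAdj v) T → length (v ∷ T) ≤ 1
  independent-∷-closedNbhd-length-≤ (v-apart ∷ _) closed =
    ≤-reflexive (cong (suc ∘ length) (isolated closed v-apart))
    where
      isolated : ∀ {v T} → All (ClosedAdj v) T → All (λ s → ¬ v ≡ s × ¬ Adj G v s) T → T ≡ []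
      isolated []              []               = refl
      isolated (inj₁ v≡s ∷ _) ((v≢s , _) ∷ _) = ⊥-elim (v≢s v≡s)
      isolated (inj₂ v~s ∷ _) ((_ , v≁s) ∷ _) = ⊥-elim (v≁s v~s)

  closedNbhd-independent-∋-length-≤ : ∀ {v T} → IsIndependent G T →
    All (ClosedAdj v) T → v ∈ T → length T ≤ 1
  closedNbhd-independent-∋-length-≤ ind (_ ∷ closed) (here refl) =
    independent-∷-closedNbhd-length-≤ ind closed
  closedNbhd-independent-∋-length-≤ ind (inj₁ refl ∷ closed) (there _) =
    independent-∷-closedNbhd-length-≤ ind closed
  closedNbhd-independent-∋-length-≤ (x-apart ∷ _) (inj₂ v~x ∷ _) (there v∈T) =
    ⊥-elim (proj₂ (All.lookup x-apart v∈T) (sym G v~x))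

  closedNbhd-independent-length-≤ : ∀ {d v T} → K1-Free (suc d) G →
    IsIndependent G T → All (ClosedAdj v) T → length T ≤ 1 ⊔ d
  closedNbhd-independent-length-≤ {d} {v} {T} k1 ind closed with v ∈? T
  ... | yes v∈T = ≤-trans (closedNbhd-independent-∋-length-≤ ind closed v∈T) (m≤m⊔n 1 d)
  ... | no  v∉T = ≤-trans (nbhd-independent-length-≤ k1 ind (All.tabulate adjacent)) (m≤n⊔m 1 d)
    where
      adjacent : ∀ {s} → s ∈ T → Adj G v s
      adjacent s∈T = [ (λ v≡s → ⊥-elim (v∉T (subst (_∈ T) (≡-sym v≡s) s∈T))) , id ] (All.lookup closed s∈T)

lemma4p4 : ∀ (d q : ℕ) → 1 ≤ d → 2 ≤ q →
    ∀ {n : ℕ} (G : Graph n) → Connected G → K1-Free d G →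
    ∀ (p : Fin q → Fin n) → IsInducedPath G q p →
    ∀ (S : List (Fin n)) → IsIndependent G S → All (InClosedNbhd G p) S →
    length S ≤ (d ∸ 1) * q
lemma4p4 zero _ () _
lemma4p4 (suc zero) _ _ (s≤s (s≤s _)) G _ k1 p (_ , path) _ _ _ =
  ⊥-elim (K1-Free-1⇒edgeless G k1 (proj₂ (path zero (suc zero)) (inj₁ refl)))
lemma4p4 (suc (suc d)) q _ _ G _ k1 p _ S ind al =
  subst (length S ≤_) (*-comm q (suc d))
    (AllPairs-covered-length-≤ (suc d) q (ClosedAdj G ∘ p)
      (λ _ _ → closedNbhd-independent-length-≤ G k1) S ind al)
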